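{- Consider lattice paths starting at the origin and using down-steps $D=(1,-1)$ and up-steps $U_j=(1,j)$ for any integer $j\ge 1$, such that no two up-steps are consecutive and the path never goes below the $x$-axis (the reversal of Dyck paths with air pockets; the endpoint may be at any height). For $k\ge0$ let $b_k(z)=\sum_n b_{k,n}z^n$, where $b_{k,n}$ is the number of such nonempty paths with $n$ steps ending at height $k$. Let $$s_2=\frac{1+z-z^2-\sqrt{1-2z-z^2-2z^3+z^4}}{2z},$$ viewed as a formal power series in $z$. Then $$1+b_0=s_2,\qquad b_k=\frac{s_2-1}{z}\,s_2^{k-1}\quad (k\ge1).$$
   Context: All generating functions are formal power series in $z$, where the exponent of $z$ records the number of steps. The square root is the formal power series with constant term $1$. -}

module Defs where

open import Data.Nat as ℕ using (ℕ; zero; suc; _∸_)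
open import Data.Bool using (Bool; true; false; _∧_)
open import Data.Maybe using (Maybe; just; nothing)
open import Data.List using (List; []; _∷_; _++_; [_]; map; concatMap; filter; length; upTo; foldr)
open import Data.Integer using (+_)
open import Data.Rational using (ℚ; 0ℚ; 1ℚ; ½; _+_; _*_; _-_; _/_)
open import Relation.Binary.PropositionalEquality using (_≡_)
open import Relation.Nullary.Decidable using (does)
open import Data.Bool using (T)

FPS : Set
FPS = ℕ → ℚ

_≋_ : FPS → FPS → Set
f ≋ g = ∀ n → f n ≡ g n

infix 4 _≋_
infixl 6 _⊕_ _⊖_
infixl 7 _⊛_
infixr 8 _^^_

sumℚ : List ℚ → ℚ
sumℚ = foldr _+_ 0ℚ

fromℕℚ : ℕ → ℚ
fromℕℚ n = (+ n) / 1

const : ℚ → FPS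
const c zero = c
const c (suc n) = 0ℚ

one : FPS
one = const 1ℚ

Z : FPS
Z (suc zero) = 1ℚ
Z _ = 0ℚ

_⊕_ : FPS → FPS → FPS
(f ⊕ g) n = f n + g n

_⊖_ : FPS → FPS → FPS
(f ⊖ g) n = f n - g n

_⊛_ : FPS → FPS → FPS
(f ⊛ g) n = sumℚ (map (λ i → f i * g (n ∸ i)) (upTo (suc n)))

_^^_ : FPS → ℕ → FPS
f ^^ zero = one
f ^^ suc k = f ⊛ (f ^^ k)

-- division by z (shift); used only on series with zero constant term
divZ : FPS → FPS
divZ f n = f (suc n)

get : List ℚ → ℕ → ℚ
get [] _ = 0ℚ
get (x ∷ xs) zero = x
get (x ∷ xs) (suc i) = get xs i

-- Formal square root with constant term 1 of a series f with f 0 = 1: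
-- the unique r with r 0 = 1 and r * r = f, via the standard recursion
-- r_{n+1} = (f_{n+1} - Σ_{i=1}^{n} r_i r_{n+1-i}) / 2.
-- sqrtCoeffs f n = [r_0, …, r_n].
sqrtCoeffs : FPS → ℕ → List ℚ
sqrtCoeffs f zero = 1ℚ ∷ []
sqrtCoeffs f (suc n) =
  let cs = sqrtCoeffs f n
      conv = sumℚ (map (λ i → get cs (suc i) * get cs (n ∸ i)) (upTo n))
  in cs ++ [ (f (suc n) - conv) * ½ ]

sqrtS : FPS → FPS
sqrtS f n = get (sqrtCoeffs f n) n

two : FPS
two = const (fromℕℚ 2)

disc : FPS
disc = one ⊖ two ⊛ Z ⊖ Z ^^ 2 ⊖ two ⊛ Z ^^ 3 ⊕ Z ^^ 4

s₂ : FPS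
s₂ = const ½ ⊛ divZ (one ⊕ Z ⊖ Z ^^ 2 ⊖ sqrtS disc)

-- Lattice paths.  D = (1,-1);  U m = the up-step U_{m+1} = (1, m+1),
-- so every up-step has height j ≥ 1.

data Step : Set where
  D : Step
  U : ℕ → Step

walk : ℕ → List Step → Maybe ℕ
walk h [] = just h
walk zero (D ∷ s) = nothing
walk (suc h) (D ∷ s) = walk h s
walk h (U m ∷ s) = walk (h ℕ.+ suc m) s

noUU : List Step → Bool
noUU [] = true
noUU (D ∷ s) = noUU s
noUU (U _ ∷ []) = true
noUU (U _ ∷ D ∷ s) = noUU (D ∷ s)
noUU (U _ ∷ U _ ∷ s) = false

nonempty : List Step → Bool
nonempty [] = false
nonempty (_ ∷ _) = true

endsAt : ℕ → Maybe ℕ → Bool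
endsAt k nothing = false
endsAt k (just h) = does (h ℕ.≟ k)

valid : ℕ → List Step → Bool
valid k s = nonempty s ∧ noUU s ∧ endsAt k (walk 0 s)

allSeqs : ℕ → ℕ → List (List Step)
allSeqs B zero = [] ∷ []
allSeqs B (suc n) =
  concatMap (λ st → map (st ∷_) (allSeqs B n)) (D ∷ map U (upTo B))

-- b_{k,n}: number of valid paths with n steps ending at height k.
-- Any such path has every up-step height ≤ k + n (final height
-- ≥ j - n), so enumerating heights in 1..k+n is exhaustive.
bcount : ℕ → ℕ → ℕ
bcount k n = length (filter (λ s → T? (valid k s)) (allSeqs (k ℕ.+ n) n))
  where
  open import Data.Bool.Properties using () renaming (T? to T?)

b : ℕ → FPS
b k n = fromℕℚ (bcount k n)

-- Cut a path before its last step.  A path at height k whose last step is not an up-step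
-- (the empty path included) comes from a path at height k + 1 by a down-step; a path at
-- height k ending with an up-step comes from a path at some height i < k that does not end
-- with an up-step.  With s = s₂ and d = (s − 1)/z, the series
--   D₀ = s,  D_{k+1} = z d s^{k+1},  U₀ = 0,  U_{k+1} = z s^{k+1}
-- satisfy the same two recursions, because s is the root with constant term 1 of
-- z s² − (1 + z − z²) s + 1 = 0, which in terms of d reads d = z s (1 + d).  Hence D_k and U_k
-- are the two generating functions, and b_k = U_k + D_k − [k = 0].
module Submission where

open import Defs
open import Data.Nat using (ℕ; _≤_; _∸_)
open import Data.Product using (_×_)

open import Algebra.Bundles using (CommutativeMonoid; CommutativeRing)
open import Algebra.Structures using (IsCommutativeRing)
import Algebra.Properties.CommutativeSemigroup as CommutativeSemigroupProperties
import Algebra.Solver.Ring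
open import Algebra.Solver.Ring.AlmostCommutativeRing
  using (_-Raw-AlmostCommutative⟶_; fromCommutativeRing)
open import Data.Bool using (Bool; true; false; _∧_; not)
open import Data.Bool.Properties using (T?)
open import Data.List
  using (List; []; _∷_; _++_; [_]; _∷ʳ_; map; concatMap; filter; length; upTo; foldr)
open import Data.List.Properties using (length-++; map-upTo; upTo-∷ʳ)
open import Data.Maybe using (Maybe; just; nothing; _>>=_)
open import Data.Nat as ℕ using (zero; suc; _<_; s≤s; _≡ᵇ_; _<ᵇ_)
import Data.Nat.Properties as ℕP
open import Data.Nat.Coprimality using (1-coprimeTo) renaming (sym to coprime-sym)
open import Data.Product using (_,_; proj₁; proj₂)
open import Data.Sum using (inj₁; inj₂)
import Data.Integer as ℤ
import Data.Integer.Properties as ℤP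
open import Data.Rational using (ℚ; mkℚ; 0ℚ; 1ℚ; ½; _+_; _*_; _-_; -_)
import Data.Rational.Properties as QP
import Data.Rational.Solver as QSolver
open import Function using (_∘_)
open import Relation.Binary.PropositionalEquality
  using (_≡_; refl; sym; trans; cong; cong₂; subst; module ≡-Reasoning)
open import Relation.Nullary using (yes; no)
import Relation.Binary.Reasoning.Setoid as SetoidReasoning

module QS = QSolver.+-*-Solver

-- Finite sums

module ListSum {c ℓ} (M : CommutativeMonoid c ℓ) where
  open CommutativeMonoid M renaming (refl to ≈-refl; sym to ≈-sym; trans to ≈-trans)
  open CommutativeSemigroupProperties commutativeSemigroup using (interchange)

  ∑ : {A : Set} → List A → (A → Carrier) → Carrier
  ∑ xs w = foldr _∙_ ε (map w xs)

  ∑-cong : ∀ {A : Set} {v w : A → Carrier} → (∀ x → v x ≈ w x) → ∀ xs → ∑ xs v ≈ ∑ xs w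
  ∑-cong p []       = ≈-refl
  ∑-cong p (x ∷ xs) = ∙-cong (p x) (∑-cong p xs)

  ∑-ε : ∀ {A : Set} (xs : List A) → ∑ xs (λ _ → ε) ≈ ε
  ∑-ε []       = ≈-refl
  ∑-ε (x ∷ xs) = ≈-trans (identityˡ _) (∑-ε xs)

  ∑-∙ : ∀ {A : Set} (v w : A → Carrier) xs → ∑ xs (λ x → v x ∙ w x) ≈ ∑ xs v ∙ ∑ xs w
  ∑-∙ v w []       = ≈-sym (identityˡ ε)
  ∑-∙ v w (x ∷ xs) =
    ≈-trans (∙-congˡ (∑-∙ v w xs)) (interchange (v x) (w x) (∑ xs v) (∑ xs w))

  ∑-++ : ∀ {A : Set} xs ys (w : A → Carrier) → ∑ (xs ++ ys) w ≈ ∑ xs w ∙ ∑ ys w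
  ∑-++ []       ys w = ≈-sym (identityˡ _)
  ∑-++ (x ∷ xs) ys w = ≈-trans (∙-congˡ (∑-++ xs ys w)) (≈-sym (assoc (w x) _ _))

  ∑-map : ∀ {A B : Set} (f : A → B) xs (w : B → Carrier) → ∑ (map f xs) w ≈ ∑ xs (w ∘ f)
  ∑-map f []       w = ≈-refl
  ∑-map f (x ∷ xs) w = ∙-congˡ (∑-map f xs w)

  ∑-concatMap : ∀ {A B : Set} (f : A → List B) xs (w : B → Carrier) →
                ∑ (concatMap f xs) w ≈ ∑ xs (λ x → ∑ (f x) w)
  ∑-concatMap f []       w = ≈-refl
  ∑-concatMap f (x ∷ xs) w =
    ≈-trans (∑-++ (f x) (concatMap f xs) w) (∙-congˡ (∑-concatMap f xs w))

  ∑-comm : ∀ {A B : Set} (xs : List A) (ys : List B) (w : A → B → Carrier) →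
           ∑ xs (λ x → ∑ ys (w x)) ≈ ∑ ys (λ y → ∑ xs (λ x → w x y))
  ∑-comm xs []       w = ∑-ε xs
  ∑-comm xs (y ∷ ys) w =
    ≈-trans (∑-∙ (λ x → w x y) (λ x → ∑ ys (w x)) xs) (∙-congˡ (∑-comm xs ys w))

  ∑-upTo-sucˡ : ∀ n (h : ℕ → Carrier) → ∑ (upTo (suc n)) h ≈ h 0 ∙ ∑ (upTo n) (h ∘ suc)
  ∑-upTo-sucˡ n h = ∙-congˡ (≈-trans
    (reflexive (cong (λ xs → ∑ xs h) (sym (map-upTo suc n)))) (∑-map suc (upTo n) h))

  ∑-upTo-sucʳ : ∀ n (h : ℕ → Carrier) → ∑ (upTo (suc n)) h ≈ ∑ (upTo n) h ∙ h n
  ∑-upTo-sucʳ n h = begin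
    ∑ (upTo (suc n)) h         ≡⟨ cong (λ xs → ∑ xs h) (sym (upTo-∷ʳ n)) ⟩
    ∑ (upTo n ∷ʳ n) h          ≈⟨ ∑-++ (upTo n) [ n ] h ⟩
    ∑ (upTo n) h ∙ (h n ∙ ε)  ≈⟨ ∙-congˡ (identityʳ (h n)) ⟩
    ∑ (upTo n) h ∙ h n         ∎
    where open SetoidReasoning setoid

  ∑-upTo-cong : ∀ {h h' : ℕ → Carrier} n → (∀ i → i < n → h i ≈ h' i) →
                ∑ (upTo n) h ≈ ∑ (upTo n) h'
  ∑-upTo-cong zero p = ≈-refl
  ∑-upTo-cong {h} {h'} (suc n) p = ≈-trans (∑-upTo-sucʳ n h) (≈-trans
    (∙-cong (∑-upTo-cong n (λ i i<n → p i (ℕP.m<n⇒m<1+n i<n))) (p n (ℕP.n<1+n n)))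
    (≈-sym (∑-upTo-sucʳ n h')))

open ListSum ℕP.+-0-commutativeMonoid
module ℚ∑ = ListSum QP.+-0-commutativeMonoid

fromℕℚ-mkℚ : ∀ n → fromℕℚ n ≡ mkℚ (ℤ.+ n) 0 (coprime-sym (1-coprimeTo n))
fromℕℚ-mkℚ n = QP.normalize-coprime (coprime-sym (1-coprimeTo n))

fromℕℚ-+ : ∀ m n → fromℕℚ (m ℕ.+ n) ≡ fromℕℚ m + fromℕℚ n
fromℕℚ-+ m n rewrite fromℕℚ-mkℚ m | fromℕℚ-mkℚ n =
  QP./-cong {p₁ = ℤ.+ (m ℕ.+ n)} {q₁ = 1}
    (sym (cong₂ ℤ._+_ (ℤP.*-identityʳ (ℤ.+ m)) (ℤP.*-identityʳ (ℤ.+ n)))) refl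

fromℕℚ-∑ : ∀ {A : Set} xs (w : A → ℕ) → fromℕℚ (∑ xs w) ≡ ℚ∑.∑ xs (fromℕℚ ∘ w)
fromℕℚ-∑ []       w = refl
fromℕℚ-∑ (x ∷ xs) w =
  trans (fromℕℚ-+ (w x) (∑ xs w)) (cong (fromℕℚ (w x) +_) (fromℕℚ-∑ xs w))

-- Formal power series

zeroₛ : FPS
zeroₛ _ = 0ℚ

negₛ : FPS → FPS
negₛ f n = - f n

scaleₛ : ℚ → FPS → FPS
scaleₛ c f n = c * f n

≋-refl : ∀ {f} → f ≋ f
≋-refl _ = refl

≋-sym : ∀ {f g} → f ≋ g → g ≋ f
≋-sym p n = sym (p n)

≋-trans : ∀ {f g h} → f ≋ g → g ≋ h → f ≋ h
≋-trans p q n = trans (p n) (q n)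

⊕-cong : ∀ {f f' g g'} → f ≋ f' → g ≋ g' → f ⊕ g ≋ f' ⊕ g'
⊕-cong p q n = cong₂ _+_ (p n) (q n)

⊖-cong : ∀ {f f' g g'} → f ≋ f' → g ≋ g' → f ⊖ g ≋ f' ⊖ g'
⊖-cong p q n = cong₂ _-_ (p n) (q n)

⊛-cong : ∀ {f f' g g'} → f ≋ f' → g ≋ g' → f ⊛ g ≋ f' ⊛ g'
⊛-cong p q n = ℚ∑.∑-cong (λ i → cong₂ _*_ (p i) (q (n ∸ i))) (upTo (suc n))

⊛-congˡ : ∀ f {g g'} → g ≋ g' → f ⊛ g ≋ f ⊛ g'
⊛-congˡ f = ⊛-cong (≋-refl {f})

⊛-congʳ : ∀ {f f'} g → f ≋ f' → f ⊛ g ≋ f' ⊛ g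
⊛-congʳ g p = ⊛-cong p (≋-refl {g})

⊛-sucˡ : ∀ f g n → (f ⊛ g) (suc n) ≡ f 0 * g (suc n) + (divZ f ⊛ g) n
⊛-sucˡ f g n = ℚ∑.∑-upTo-sucˡ (suc n) (λ i → f i * g (suc n ∸ i))

⊛-sucʳ : ∀ f g n → (f ⊛ g) (suc n) ≡ (f ⊛ divZ g) n + f (suc n) * g 0
⊛-sucʳ f g zero =
  QS.solve 4 (λ a b c d → a QS.:* b QS.:+ (c QS.:* d QS.:+ QS.con 0ℚ)
                          QS.:= (a QS.:* b QS.:+ QS.con 0ℚ) QS.:+ c QS.:* d)
    refl (f 0) (g 1) (f 1) (g 0)
⊛-sucʳ f g (suc n) = begin
  (f ⊛ g) (suc (suc n))
    ≡⟨ ⊛-sucˡ f g (suc n) ⟩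
  f 0 * g (suc (suc n)) + (divZ f ⊛ g) (suc n)
    ≡⟨ cong (f 0 * g (suc (suc n)) +_) (⊛-sucʳ (divZ f) g n) ⟩
  f 0 * g (suc (suc n)) + ((divZ f ⊛ divZ g) n + f (suc (suc n)) * g 0)
    ≡⟨ sym (QP.+-assoc (f 0 * g (suc (suc n))) _ _) ⟩
  (f 0 * g (suc (suc n)) + (divZ f ⊛ divZ g) n) + f (suc (suc n)) * g 0
    ≡⟨ cong (_+ f (suc (suc n)) * g 0) (sym (⊛-sucˡ f (divZ g) n)) ⟩
  (f ⊛ divZ g) (suc n) + f (suc (suc n)) * g 0 ∎
  where open ≡-Reasoning

⊛-zeroˡ : ∀ g n → (zeroₛ ⊛ g) n ≡ 0ℚ
⊛-zeroˡ g zero    = cong (_+ 0ℚ) (QP.*-zeroˡ (g 0))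
⊛-zeroˡ g (suc n) = trans (⊛-sucˡ zeroₛ g n)
  (cong₂ _+_ (QP.*-zeroˡ (g (suc n))) (⊛-zeroˡ g n))

const-⊛ : ∀ c g n → (const c ⊛ g) n ≡ c * g n
const-⊛ c g zero    = QP.+-identityʳ (c * g 0)
const-⊛ c g (suc n) = trans (⊛-sucˡ (const c) g n)
  (trans (cong (c * g (suc n) +_) (⊛-zeroˡ g n)) (QP.+-identityʳ _))

⊛-identityˡ : ∀ g → one ⊛ g ≋ g
⊛-identityˡ g n = trans (const-⊛ 1ℚ g n) (QP.*-identityˡ (g n))

scale-⊛ : ∀ c f g n → (scaleₛ c f ⊛ g) n ≡ c * (f ⊛ g) n
scale-⊛ c f g zero =
  QS.solve 3 (λ c a b → (c QS.:* a) QS.:* b QS.:+ QS.con 0ℚ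
                        QS.:= c QS.:* (a QS.:* b QS.:+ QS.con 0ℚ))
    refl c (f 0) (g 0)
scale-⊛ c f g (suc n) = begin
  (scaleₛ c f ⊛ g) (suc n)
    ≡⟨ ⊛-sucˡ (scaleₛ c f) g n ⟩
  c * f 0 * g (suc n) + (scaleₛ c (divZ f) ⊛ g) n
    ≡⟨ cong (c * f 0 * g (suc n) +_) (scale-⊛ c (divZ f) g n) ⟩
  c * f 0 * g (suc n) + c * (divZ f ⊛ g) n
    ≡⟨ QS.solve 4 (λ c a b x → c QS.:* a QS.:* b QS.:+ c QS.:* x QS.:= c QS.:* (a QS.:* b QS.:+ x))
         refl c (f 0) (g (suc n)) _ ⟩
  c * (f 0 * g (suc n) + (divZ f ⊛ g) n)
    ≡⟨ cong (c *_) (sym (⊛-sucˡ f g n)) ⟩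
  c * (f ⊛ g) (suc n) ∎
  where open ≡-Reasoning

⊛-distribʳ : ∀ f g h n → ((f ⊕ g) ⊛ h) n ≡ (f ⊛ h) n + (g ⊛ h) n
⊛-distribʳ f g h zero =
  QS.solve 3 (λ a b c → (a QS.:+ b) QS.:* c QS.:+ QS.con 0ℚ
                        QS.:= (a QS.:* c QS.:+ QS.con 0ℚ) QS.:+ (b QS.:* c QS.:+ QS.con 0ℚ))
    refl (f 0) (g 0) (h 0)
⊛-distribʳ f g h (suc n) = begin
  ((f ⊕ g) ⊛ h) (suc n)
    ≡⟨ ⊛-sucˡ (f ⊕ g) h n ⟩
  (f 0 + g 0) * h (suc n) + ((divZ f ⊕ divZ g) ⊛ h) n
    ≡⟨ cong ((f 0 + g 0) * h (suc n) +_) (⊛-distribʳ (divZ f) (divZ g) h n) ⟩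
  (f 0 + g 0) * h (suc n) + ((divZ f ⊛ h) n + (divZ g ⊛ h) n)
    ≡⟨ QS.solve 5 (λ a b c x y → (a QS.:+ b) QS.:* c QS.:+ (x QS.:+ y)
                                 QS.:= (a QS.:* c QS.:+ x) QS.:+ (b QS.:* c QS.:+ y))
         refl (f 0) (g 0) (h (suc n)) _ _ ⟩
  (f 0 * h (suc n) + (divZ f ⊛ h) n) + (g 0 * h (suc n) + (divZ g ⊛ h) n)
    ≡⟨ sym (cong₂ _+_ (⊛-sucˡ f h n) (⊛-sucˡ g h n)) ⟩
  (f ⊛ h) (suc n) + (g ⊛ h) (suc n) ∎
  where open ≡-Reasoning

⊛-comm : ∀ f g → f ⊛ g ≋ g ⊛ f
⊛-comm f g zero    = cong (_+ 0ℚ) (QP.*-comm (f 0) (g 0))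
⊛-comm f g (suc n) = begin
  (f ⊛ g) (suc n)                    ≡⟨ ⊛-sucˡ f g n ⟩
  f 0 * g (suc n) + (divZ f ⊛ g) n   ≡⟨ cong₂ _+_ (QP.*-comm (f 0) (g (suc n))) (⊛-comm (divZ f) g n) ⟩
  g (suc n) * f 0 + (g ⊛ divZ f) n   ≡⟨ QP.+-comm (g (suc n) * f 0) _ ⟩
  (g ⊛ divZ f) n + g (suc n) * f 0   ≡⟨ sym (⊛-sucʳ g f n) ⟩
  (g ⊛ f) (suc n)                    ∎
  where open ≡-Reasoning

⊛-identityʳ : ∀ f → f ⊛ one ≋ f
⊛-identityʳ f = ≋-trans (⊛-comm f one) (⊛-identityˡ f)

⊛-distribˡ : ∀ f g h n → (f ⊛ (g ⊕ h)) n ≡ (f ⊛ g) n + (f ⊛ h) n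
⊛-distribˡ f g h n = begin
  (f ⊛ (g ⊕ h)) n              ≡⟨ ⊛-comm f (g ⊕ h) n ⟩
  ((g ⊕ h) ⊛ f) n              ≡⟨ ⊛-distribʳ g h f n ⟩
  (g ⊛ f) n + (h ⊛ f) n        ≡⟨ cong₂ _+_ (⊛-comm g f n) (⊛-comm h f n) ⟩
  (f ⊛ g) n + (f ⊛ h) n        ∎
  where open ≡-Reasoning

⊛-assoc : ∀ f g h → (f ⊛ g) ⊛ h ≋ f ⊛ (g ⊛ h)
⊛-assoc f g h zero =
  QS.solve 3 (λ a b c → (a QS.:* b QS.:+ QS.con 0ℚ) QS.:* c QS.:+ QS.con 0ℚ
                        QS.:= a QS.:* (b QS.:* c QS.:+ QS.con 0ℚ) QS.:+ QS.con 0ℚ)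
    refl (f 0) (g 0) (h 0)
⊛-assoc f g h (suc n) = begin
  ((f ⊛ g) ⊛ h) (suc n)
    ≡⟨ ⊛-sucˡ (f ⊛ g) h n ⟩
  fg₀ * h (suc n) + (divZ (f ⊛ g) ⊛ h) n
    ≡⟨ cong (fg₀ * h (suc n) +_) (⊛-congʳ h (⊛-sucˡ f g) n) ⟩
  fg₀ * h (suc n) + ((scaleₛ (f 0) (divZ g) ⊕ (divZ f ⊛ g)) ⊛ h) n
    ≡⟨ cong (fg₀ * h (suc n) +_) (⊛-distribʳ (scaleₛ (f 0) (divZ g)) (divZ f ⊛ g) h n) ⟩
  fg₀ * h (suc n) + ((scaleₛ (f 0) (divZ g) ⊛ h) n + ((divZ f ⊛ g) ⊛ h) n)
    ≡⟨ cong (fg₀ * h (suc n) +_) (cong₂ _+_ (scale-⊛ (f 0) (divZ g) h n) (⊛-assoc (divZ f) g h n)) ⟩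
  fg₀ * h (suc n) + (f 0 * (divZ g ⊛ h) n + (divZ f ⊛ (g ⊛ h)) n)
    ≡⟨ QS.solve 5 (λ a b c x y → (a QS.:* b QS.:+ QS.con 0ℚ) QS.:* c QS.:+ (a QS.:* x QS.:+ y)
                                 QS.:= a QS.:* (b QS.:* c QS.:+ x) QS.:+ y)
         refl (f 0) (g 0) (h (suc n)) _ _ ⟩
  f 0 * (g 0 * h (suc n) + (divZ g ⊛ h) n) + (divZ f ⊛ (g ⊛ h)) n
    ≡⟨ cong (λ x → f 0 * x + (divZ f ⊛ (g ⊛ h)) n) (sym (⊛-sucˡ g h n)) ⟩
  f 0 * (g ⊛ h) (suc n) + (divZ f ⊛ (g ⊛ h)) n
    ≡⟨ sym (⊛-sucˡ f (g ⊛ h) n) ⟩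
  (f ⊛ (g ⊛ h)) (suc n) ∎
  where
  open ≡-Reasoning
  fg₀ = (f ⊛ g) 0

FPS-isCommutativeRing : IsCommutativeRing _≋_ _⊕_ _⊛_ negₛ zeroₛ one
FPS-isCommutativeRing = record
  { isRing = record
    { +-isAbelianGroup = record
      { isGroup = record
        { isMonoid = record
          { isSemigroup = record
            { isMagma = record
              { isEquivalence = record { refl = ≋-refl ; sym = ≋-sym ; trans = ≋-trans }
              ; ∙-cong = ⊕-cong }
            ; assoc = λ f g h n → QP.+-assoc (f n) (g n) (h n) }
          ; identity = (λ f n → QP.+-identityˡ (f n)) , (λ f n → QP.+-identityʳ (f n)) }
        ; inverse = (λ f n → QP.+-inverseˡ (f n)) , (λ f n → QP.+-inverseʳ (f n))
        ; ⁻¹-cong = λ p n → cong -_ (p n) }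
      ; comm = λ f g n → QP.+-comm (f n) (g n) }
    ; *-cong = ⊛-cong
    ; *-assoc = ⊛-assoc
    ; *-identity = ⊛-identityˡ , ⊛-identityʳ
    ; distrib = ⊛-distribˡ , (λ f g h → ⊛-distribʳ g h f) }
  ; *-comm = ⊛-comm }

FPS-commutativeRing : CommutativeRing _ _
FPS-commutativeRing = record { isCommutativeRing = FPS-isCommutativeRing }

const-homomorphism : QP.+-*-rawRing -Raw-AlmostCommutative⟶ fromCommutativeRing FPS-commutativeRing
const-homomorphism = record
  { ⟦_⟧    = const
  ; +-homo = λ a b → λ { zero → refl ; (suc n) → refl }
  ; *-homo = λ a b → λ { zero    → sym (const-⊛ a (const b) 0)
                        ; (suc n) → sym (trans (const-⊛ a (const b) (suc n)) (QP.*-zeroʳ a)) }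
  ; -‿homo = λ a → λ { zero → refl ; (suc n) → refl }
  ; 0-homo = λ { zero → refl ; (suc n) → refl }
  ; 1-homo = λ _ → refl }

const-≟ : ∀ a b → Maybe (const a ≋ const b)
const-≟ a b with a QP.≟ b
... | yes refl = just ≋-refl
... | no _     = nothing

module FPS-Solver =
  Algebra.Solver.Ring QP.+-*-rawRing (fromCommutativeRing FPS-commutativeRing) const-homomorphism const-≟
open FPS-Solver using (solve; _:=_; _:+_; _:-_; _:*_; _:^_; con)

module ≋-Reasoning = SetoidReasoning (CommutativeRing.setoid FPS-commutativeRing)

Z⊛-zero : ∀ g → (Z ⊛ g) 0 ≡ 0ℚ
Z⊛-zero g = cong (_+ 0ℚ) (QP.*-zeroˡ (g 0))

Z⊛-suc : ∀ g n → (Z ⊛ g) (suc n) ≡ g n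
Z⊛-suc g n = begin
  (Z ⊛ g) (suc n)                  ≡⟨ ⊛-sucˡ Z g n ⟩
  0ℚ * g (suc n) + (divZ Z ⊛ g) n  ≡⟨ cong₂ _+_ (QP.*-zeroˡ (g (suc n))) (⊛-congʳ g divZ-Z n) ⟩
  0ℚ + (one ⊛ g) n                 ≡⟨ QP.+-identityˡ _ ⟩
  (one ⊛ g) n                      ≡⟨ ⊛-identityˡ g n ⟩
  g n                              ∎
  where
  open ≡-Reasoning
  divZ-Z : divZ Z ≋ one
  divZ-Z zero    = refl
  divZ-Z (suc n) = refl

Z⊛-cancel : ∀ {f} → Z ⊛ f ≋ zeroₛ → f ≋ zeroₛ
Z⊛-cancel {f} p n = trans (sym (Z⊛-suc f n)) (p (suc n))

⊖≋zero⇒≋ : ∀ {f g} → f ⊖ g ≋ zeroₛ → f ≋ g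
⊖≋zero⇒≋ {f} {g} p n = begin
  f n                ≡⟨ QS.solve 2 (λ a b → a QS.:= (a QS.:- b) QS.:+ b) refl (f n) (g n) ⟩
  (f n - g n) + g n  ≡⟨ cong (_+ g n) (p n) ⟩
  0ℚ + g n           ≡⟨ QP.+-identityˡ (g n) ⟩
  g n                ∎
  where open ≡-Reasoning

-- The formal square root

length-sqrtCoeffs : ∀ f n → length (sqrtCoeffs f n) ≡ suc n
length-sqrtCoeffs f zero    = refl
length-sqrtCoeffs f (suc n) = trans (length-++ (sqrtCoeffs f n))
  (trans (cong (ℕ._+ 1) (length-sqrtCoeffs f n)) (ℕP.+-comm (suc n) 1))

get-++ˡ : ∀ (xs ys : List ℚ) i → i < length xs → get (xs ++ ys) i ≡ get xs i
get-++ˡ (x ∷ xs) ys zero    _       = refl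
get-++ˡ (x ∷ xs) ys (suc i) (s≤s p) = get-++ˡ xs ys i p

get-∷ʳ : ∀ (xs : List ℚ) y i → i ≡ length xs → get (xs ∷ʳ y) i ≡ y
get-∷ʳ []       y zero    _ = refl
get-∷ʳ (x ∷ xs) y (suc i) p = get-∷ʳ xs y i (ℕP.suc-injective p)

get-sqrtCoeffs : ∀ f n i → i ≤ n → get (sqrtCoeffs f n) i ≡ sqrtS f i
get-sqrtCoeffs f zero    zero _ = refl
get-sqrtCoeffs f (suc n) i i≤1+n with ℕP.m≤n⇒m<n∨m≡n i≤1+n
... | inj₂ refl      = refl
... | inj₁ (s≤s i≤n) = trans
  (get-++ˡ (sqrtCoeffs f n) _ i (subst (i <_) (sym (length-sqrtCoeffs f n)) (s≤s i≤n)))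
  (get-sqrtCoeffs f n i i≤n)

sqrtS-suc : ∀ f n → sqrtS f (suc n) ≡
  (f (suc n) - ℚ∑.∑ (upTo n) (λ i → sqrtS f (suc i) * sqrtS f (n ∸ i))) * ½
sqrtS-suc f n = trans (get-∷ʳ (sqrtCoeffs f n) _ (suc n) (sym (length-sqrtCoeffs f n)))
  (cong (λ c → (f (suc n) - c) * ½) (ℚ∑.∑-upTo-cong n (λ i i<n →
    cong₂ _*_ (get-sqrtCoeffs f n (suc i) i<n) (get-sqrtCoeffs f n (n ∸ i) (ℕP.m∸n≤m n i)))))

sqrtS-square : ∀ f → f 0 ≡ 1ℚ → sqrtS f ⊛ sqrtS f ≋ f
sqrtS-square f f₀≡1 zero    = sym f₀≡1
sqrtS-square f f₀≡1 (suc n) = begin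
  (r ⊛ r) (suc n)
    ≡⟨ ⊛-sucˡ r r n ⟩
  1ℚ * r (suc n) + (divZ r ⊛ r) n
    ≡⟨ cong (1ℚ * r (suc n) +_) (ℚ∑.∑-upTo-sucʳ n (λ i → r (suc i) * r (n ∸ i))) ⟩
  1ℚ * r (suc n) + (c + r (suc n) * r (n ∸ n))
    ≡⟨ cong (λ k → 1ℚ * r (suc n) + (c + r (suc n) * r k)) (ℕP.n∸n≡0 n) ⟩
  1ℚ * r (suc n) + (c + r (suc n) * 1ℚ)
    ≡⟨ cong (λ x → 1ℚ * x + (c + x * 1ℚ)) (sqrtS-suc f n) ⟩
  1ℚ * ((f (suc n) - c) * ½) + (c + (f (suc n) - c) * ½ * 1ℚ)
    ≡⟨ QS.solve 2 (λ a c → QS.con 1ℚ QS.:* ((a QS.:- c) QS.:* QS.con ½)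
                           QS.:+ (c QS.:+ (a QS.:- c) QS.:* QS.con ½ QS.:* QS.con 1ℚ) QS.:= a)
         refl (f (suc n)) c ⟩
  f (suc n) ∎
  where
  open ≡-Reasoning
  r = sqrtS f
  c = ℚ∑.∑ (upTo n) (λ i → r (suc i) * r (n ∸ i))

-- The series s₂ and its functional equation

-- s₂ = (P − √disc) / (2z), and disc = P² − 4z.
P : FPS
P = one ⊕ Z ⊖ Z ^^ 2

sqrtS-disc : sqrtS disc ≋ P ⊖ two ⊛ (Z ⊛ s₂)
sqrtS-disc zero = sym (begin
  P 0 - (two ⊛ (Z ⊛ s₂)) 0    ≡⟨ cong (λ x → P 0 - x) (const-⊛ (fromℕℚ 2) (Z ⊛ s₂) 0) ⟩
  P 0 - fromℕℚ 2 * (Z ⊛ s₂) 0 ≡⟨ cong (λ x → P 0 - fromℕℚ 2 * x) (Z⊛-zero s₂) ⟩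
  1ℚ                          ∎)
  where open ≡-Reasoning
sqrtS-disc (suc n) = sym (begin
  P (suc n) - (two ⊛ (Z ⊛ s₂)) (suc n)
    ≡⟨ cong (λ x → P (suc n) - x) (const-⊛ (fromℕℚ 2) (Z ⊛ s₂) (suc n)) ⟩
  P (suc n) - fromℕℚ 2 * (Z ⊛ s₂) (suc n)
    ≡⟨ cong (λ x → P (suc n) - fromℕℚ 2 * x) (Z⊛-suc s₂ n) ⟩
  P (suc n) - fromℕℚ 2 * s₂ n
    ≡⟨ cong (λ x → P (suc n) - fromℕℚ 2 * x) (const-⊛ ½ (divZ (P ⊖ sqrtS disc)) n) ⟩
  P (suc n) - fromℕℚ 2 * (½ * (P (suc n) - sqrtS disc (suc n)))
    ≡⟨ QS.solve 2 (λ p q → p QS.:- QS.con (fromℕℚ 2) QS.:* (QS.con ½ QS.:* (p QS.:- q)) QS.:= q)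
         refl (P (suc n)) (sqrtS disc (suc n)) ⟩
  sqrtS disc (suc n) ∎)
  where open ≡-Reasoning

d₂ : FPS
d₂ = divZ (s₂ ⊖ one)

s₂≋1+zd₂ : s₂ ≋ one ⊕ Z ⊛ d₂
s₂≋1+zd₂ zero    = sym (cong (1ℚ +_) (Z⊛-zero d₂))
s₂≋1+zd₂ (suc n) = sym (begin
  0ℚ + (Z ⊛ d₂) (suc n)  ≡⟨ QP.+-identityˡ _ ⟩
  (Z ⊛ d₂) (suc n)       ≡⟨ Z⊛-suc d₂ n ⟩
  s₂ (suc n) + - 0ℚ      ≡⟨ QP.+-identityʳ (s₂ (suc n)) ⟩
  s₂ (suc n)             ∎)
  where open ≡-Reasoning

d₂-fixpoint : d₂ ≋ Z ⊛ (s₂ ⊛ (one ⊕ d₂))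
d₂-fixpoint = begin
  d₂                     ≈⟨ ≋-sym (⊖≋zero⇒≋ (Z⊛-cancel (Z⊛-cancel z²-root))) ⟩
  Z ⊛ (s ⊛ (one ⊕ d₂))   ≈⟨ ⊛-congˡ Z (⊛-congʳ (one ⊕ d₂) (≋-sym s₂≋1+zd₂)) ⟩
  Z ⊛ (s₂ ⊛ (one ⊕ d₂))  ∎
  where
  open ≋-Reasoning
  s = one ⊕ Z ⊛ d₂
  r = P ⊖ two ⊛ (Z ⊛ s)
  ¼ = ½ * ½
  r≋sqrt : r ≋ sqrtS disc
  r≋sqrt = ≋-sym (≋-trans sqrtS-disc
    (⊖-cong (≋-refl {P}) (⊛-congˡ two (⊛-congˡ Z s₂≋1+zd₂))))
  r²−disc≋0 : sqrtS disc ⊛ sqrtS disc ⊖ disc ≋ zeroₛ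
  r²−disc≋0 n = trans (cong (_- disc n) (sqrtS-square disc refl n)) (QP.+-inverseʳ (disc n))
  -- (P − 2zs)² − (P² − 4z) = 4z (z s² − P s + 1), and for s = 1 + z d the last factor is
  -- z (z s (1 + d) − d).
  z²-root : Z ⊛ (Z ⊛ (Z ⊛ (s ⊛ (one ⊕ d₂)) ⊖ d₂)) ≋ zeroₛ
  z²-root = begin
    Z ⊛ (Z ⊛ (Z ⊛ (s ⊛ (one ⊕ d₂)) ⊖ d₂))
      ≈⟨ solve 2 (λ z d →
           let s = con 1ℚ :+ z :* d
               p = con 1ℚ :+ z :- z :^ 2
               r = p :- con (fromℕℚ 2) :* (z :* s)
               Δ = con 1ℚ :- con (fromℕℚ 2) :* z :- z :^ 2 :- con (fromℕℚ 2) :* z :^ 3 :+ z :^ 4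
           in z :* (z :* (z :* (s :* (con 1ℚ :+ d)) :- d)) := con ¼ :* (r :* r :- Δ))
           ≋-refl Z d₂ ⟩
    const ¼ ⊛ (r ⊛ r ⊖ disc)
      ≈⟨ ⊛-congˡ (const ¼) (≋-trans (⊖-cong (⊛-cong r≋sqrt r≋sqrt) (≋-refl {disc})) r²−disc≋0) ⟩
    const ¼ ⊛ zeroₛ
      ≈⟨ (λ n → trans (const-⊛ ¼ zeroₛ n) (QP.*-zeroʳ ¼)) ⟩
    zeroₛ ∎

-- Generating functions of paths by height and last step

d₂⊛s₂^-unfold : ∀ k → d₂ ⊛ s₂ ^^ k ≋ Z ⊛ s₂ ^^ suc k ⊕ Z ⊛ (d₂ ⊛ s₂ ^^ suc k)
d₂⊛s₂^-unfold k = ≋-trans (⊛-congʳ (s₂ ^^ k) d₂-fixpoint)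
  (solve 4 (λ z d s t → z :* (s :* (con 1ℚ :+ d)) :* t := z :* (s :* t) :+ z :* (d :* (s :* t)))
     ≋-refl Z d₂ s₂ (s₂ ^^ k))

Dgf : ℕ → FPS
Dgf zero    = s₂
Dgf (suc k) = Z ⊛ (d₂ ⊛ s₂ ^^ suc k)

Ugf : ℕ → FPS
Ugf zero    = zeroₛ
Ugf (suc k) = Z ⊛ s₂ ^^ suc k

Dgf-suc : ∀ k n → Dgf k (suc n) ≡ Ugf (suc k) n + Dgf (suc k) n
Dgf-suc zero n = begin
  s₂ (suc n)                  ≡⟨ s₂≋1+zd₂ (suc n) ⟩
  0ℚ + (Z ⊛ d₂) (suc n)       ≡⟨ trans (QP.+-identityˡ _) (Z⊛-suc d₂ n) ⟩
  d₂ n                        ≡⟨ sym (⊛-identityʳ d₂ n) ⟩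
  (d₂ ⊛ s₂ ^^ 0) n            ≡⟨ d₂⊛s₂^-unfold 0 n ⟩
  Ugf 1 n + Dgf 1 n           ∎
  where open ≡-Reasoning
Dgf-suc (suc k) n = trans (Z⊛-suc (d₂ ⊛ s₂ ^^ suc k) n) (d₂⊛s₂^-unfold (suc k) n)

∑-Dgf : ∀ k n → ℚ∑.∑ (upTo (suc k)) (λ i → Dgf i n) ≡ (s₂ ^^ suc k) n
∑-Dgf zero    n = trans (QP.+-identityʳ (s₂ n)) (sym (⊛-identityʳ s₂ n))
∑-Dgf (suc k) n = begin
  ℚ∑.∑ (upTo (suc (suc k))) (λ i → Dgf i n)
    ≡⟨ ℚ∑.∑-upTo-sucʳ (suc k) (λ i → Dgf i n) ⟩
  ℚ∑.∑ (upTo (suc k)) (λ i → Dgf i n) + Dgf (suc k) n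
    ≡⟨ cong (_+ Dgf (suc k) n) (∑-Dgf k n) ⟩
  (s₂ ^^ suc k) n + (Z ⊛ (d₂ ⊛ s₂ ^^ suc k)) n
    ≡⟨ solve 3 (λ z d t → t :+ z :* (d :* t) := (con 1ℚ :+ z :* d) :* t)
         ≋-refl Z d₂ (s₂ ^^ suc k) n ⟩
  ((one ⊕ Z ⊛ d₂) ⊛ s₂ ^^ suc k) n
    ≡⟨ ⊛-congʳ (s₂ ^^ suc k) (≋-sym s₂≋1+zd₂) n ⟩
  (s₂ ^^ suc (suc k)) n ∎
  where open ≡-Reasoning

Ugf-suc : ∀ k n → Ugf (suc k) (suc n) ≡ ℚ∑.∑ (upTo (suc k)) (λ i → Dgf i n)
Ugf-suc k n = trans (Z⊛-suc (s₂ ^^ suc k) n) (sym (∑-Dgf k n))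

-- Counting paths by their last step

isUp : Step → Bool
isUp D     = false
isUp (U _) = true

walk-U : ∀ h m → walk h [ U m ] ≡ just (h ℕ.+ suc m)
walk-U zero    m = refl
walk-U (suc h) m = refl

endsUp : List Step → Bool
endsUp []          = false
endsUp (st ∷ [])   = isUp st
endsUp (_ ∷ st ∷ s) = endsUp (st ∷ s)

walk-∷ʳ : ∀ h s st → walk h (s ∷ʳ st) ≡ (walk h s >>= λ h' → walk h' [ st ])
walk-∷ʳ h       []          st = refl
walk-∷ʳ zero    (D ∷ s)     st = refl
walk-∷ʳ (suc h) (D ∷ s)     st = walk-∷ʳ h s st
walk-∷ʳ zero    (U m ∷ s)   st = walk-∷ʳ (suc m) s st
walk-∷ʳ (suc h) (U m ∷ s)   st = walk-∷ʳ (suc h ℕ.+ suc m) s st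

endsUp-∷ʳ : ∀ s st → endsUp (s ∷ʳ st) ≡ isUp st
endsUp-∷ʳ []           st = refl
endsUp-∷ʳ (_ ∷ [])     st = refl
endsUp-∷ʳ (_ ∷ x ∷ s)  st = endsUp-∷ʳ (x ∷ s) st

noUU-∷ʳ : ∀ s st → noUU (s ∷ʳ st) ≡ noUU s ∧ not (endsUp s ∧ isUp st)
noUU-∷ʳ []              D      = refl
noUU-∷ʳ []              (U _)  = refl
noUU-∷ʳ (D ∷ [])        D      = refl
noUU-∷ʳ (D ∷ [])        (U _)  = refl
noUU-∷ʳ (D ∷ x ∷ s)     st     = noUU-∷ʳ (x ∷ s) st
noUU-∷ʳ (U _ ∷ [])      D      = refl
noUU-∷ʳ (U _ ∷ [])      (U _)  = refl
noUU-∷ʳ (U _ ∷ D ∷ s)   st     = noUU-∷ʳ (D ∷ s) st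
noUU-∷ʳ (U _ ∷ U _ ∷ s) st     = refl

-- Whether no two up-steps are consecutive, the current height (nothing once the path has
-- gone below the axis), and whether the last step is an up-step.
Summary : Set
Summary = Bool × Maybe ℕ × Bool

summary : List Step → Summary
summary s = noUU s , walk 0 s , endsUp s

extend : Summary → Step → Summary
extend (ok , height , up) st = ok ∧ not (up ∧ isUp st) , (height >>= λ h → walk h [ st ]) , isUp st

summary-∷ʳ : ∀ s st → summary (s ∷ʳ st) ≡ extend (summary s) st
summary-∷ʳ s st rewrite noUU-∷ʳ s st | walk-∷ʳ 0 s st | endsUp-∷ʳ s st = refl

𝟙 : Bool → ℕ
𝟙 true  = 1
𝟙 false = 0

weight : ℕ → Bool → Summary → ℕ
weight k up    (false , _      , _    ) = 0
weight k up    (true  , nothing , _    ) = 0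
weight k false (true  , just h , false) = 𝟙 (h ≡ᵇ k)
weight k false (true  , just h , true ) = 0
weight k true  (true  , just h , false) = 0
weight k true  (true  , just h , true ) = 𝟙 (h ≡ᵇ k)

weight-false-up : ∀ k ok height → weight k false (ok , height , true) ≡ 0
weight-false-up k false height   = refl
weight-false-up k true  nothing  = refl
weight-false-up k true  (just h) = refl

weight-true-down : ∀ k ok height → weight k true (ok , height , false) ≡ 0
weight-true-down k false height   = refl
weight-true-down k true  nothing  = refl
weight-true-down k true  (just h) = refl

𝟙<ᵇ-suc : ∀ h k → 𝟙 (h <ᵇ k) ℕ.+ 𝟙 (h ≡ᵇ k) ≡ 𝟙 (h <ᵇ suc k)
𝟙<ᵇ-suc zero    zero    = refl
𝟙<ᵇ-suc zero    (suc k) = refl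
𝟙<ᵇ-suc (suc h) zero    = refl
𝟙<ᵇ-suc (suc h) (suc k) = 𝟙<ᵇ-suc h k

𝟙<ᵇ-sucˡ : ∀ h k → 𝟙 (suc h ≡ᵇ k) ℕ.+ 𝟙 (suc h <ᵇ k) ≡ 𝟙 (h <ᵇ k)
𝟙<ᵇ-sucˡ h       zero          = refl
𝟙<ᵇ-sucˡ zero    (suc zero)    = refl
𝟙<ᵇ-sucˡ zero    (suc (suc k)) = refl
𝟙<ᵇ-sucˡ (suc h) (suc k)       = 𝟙<ᵇ-sucˡ h k

𝟙<ᵇ-≤ : ∀ h k → k ≤ h → 𝟙 (h <ᵇ k) ≡ 0
𝟙<ᵇ-≤ h       zero    _       = refl
𝟙<ᵇ-≤ (suc h) (suc k) (s≤s p) = 𝟙<ᵇ-≤ h k p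

∑-𝟙≡ᵇ : ∀ h k → ∑ (upTo k) (λ i → 𝟙 (h ≡ᵇ i)) ≡ 𝟙 (h <ᵇ k)
∑-𝟙≡ᵇ h zero    = refl
∑-𝟙≡ᵇ h (suc k) = trans (∑-upTo-sucʳ k (λ i → 𝟙 (h ≡ᵇ i)))
  (trans (cong (ℕ._+ 𝟙 (h ≡ᵇ k)) (∑-𝟙≡ᵇ h k)) (𝟙<ᵇ-suc h k))

∑-𝟙-up : ∀ h B k → k ≤ h ℕ.+ B → ∑ (upTo B) (λ m → 𝟙 (h ℕ.+ suc m ≡ᵇ k)) ≡ 𝟙 (h <ᵇ k)
∑-𝟙-up h zero    k k≤h+0 = sym (𝟙<ᵇ-≤ h k (subst (k ≤_) (ℕP.+-identityʳ h) k≤h+0))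
∑-𝟙-up h (suc B) k k≤h+B = begin
  ∑ (upTo (suc B)) (λ m → 𝟙 (h ℕ.+ suc m ≡ᵇ k))
    ≡⟨ ∑-upTo-sucˡ B (λ m → 𝟙 (h ℕ.+ suc m ≡ᵇ k)) ⟩
  𝟙 (h ℕ.+ 1 ≡ᵇ k) ℕ.+ ∑ (upTo B) (λ m → 𝟙 (h ℕ.+ suc (suc m) ≡ᵇ k))
    ≡⟨ cong₂ ℕ._+_ (cong (λ x → 𝟙 (x ≡ᵇ k)) (ℕP.+-comm h 1))
                   (∑-cong (λ m → cong (λ x → 𝟙 (x ≡ᵇ k)) (ℕP.+-suc h (suc m))) (upTo B)) ⟩
  𝟙 (suc h ≡ᵇ k) ℕ.+ ∑ (upTo B) (λ m → 𝟙 (suc h ℕ.+ suc m ≡ᵇ k))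
    ≡⟨ cong (𝟙 (suc h ≡ᵇ k) ℕ.+_) (∑-𝟙-up (suc h) B k (subst (k ≤_) (ℕP.+-suc h B) k≤h+B)) ⟩
  𝟙 (suc h ≡ᵇ k) ℕ.+ 𝟙 (suc h <ᵇ k)
    ≡⟨ 𝟙<ᵇ-sucˡ h k ⟩
  𝟙 (h <ᵇ k) ∎
  where open ≡-Reasoning

steps : ℕ → List Step
steps B = D ∷ map U (upTo B)

∑-steps : ∀ B (w : Step → ℕ) → ∑ (steps B) w ≡ w D ℕ.+ ∑ (upTo B) (w ∘ U)
∑-steps B w = cong (w D ℕ.+_) (∑-map U (upTo B) w)

extend-down : ∀ B k σ →
  ∑ (steps B) (λ st → weight k false (extend σ st)) ≡ weight (suc k) true σ ℕ.+ weight (suc k) false σ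
extend-down B k σ = begin
  ∑ (steps B) (λ st → weight k false (extend σ st))
    ≡⟨ ∑-steps B _ ⟩
  weight k false (extend σ D) ℕ.+ ∑ (upTo B) (λ m → weight k false (extend σ (U m)))
    ≡⟨ cong (weight k false (extend σ D) ℕ.+_)
            (trans (∑-cong (λ m → up-step σ) (upTo B)) (∑-ε (upTo B))) ⟩
  weight k false (extend σ D) ℕ.+ 0
    ≡⟨ ℕP.+-identityʳ _ ⟩
  weight k false (extend σ D)
    ≡⟨ down-step σ ⟩
  weight (suc k) true σ ℕ.+ weight (suc k) false σ ∎
  where
  open ≡-Reasoning
  up-step : ∀ σ {m} → weight k false (extend σ (U m)) ≡ 0
  up-step (ok , height , up) {m} =
    weight-false-up k (ok ∧ not (up ∧ true)) (height >>= λ h → walk h [ U m ])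
  down-step : ∀ σ → weight k false (extend σ D) ≡ weight (suc k) true σ ℕ.+ weight (suc k) false σ
  down-step (false , _              , _)     = refl
  down-step (true  , nothing        , false) = refl
  down-step (true  , nothing        , true)  = refl
  down-step (true  , just zero      , false) = refl
  down-step (true  , just zero      , true)  = refl
  down-step (true  , just (suc h)   , false) = refl
  down-step (true  , just (suc h)   , true)  = sym (ℕP.+-identityʳ _)

extend-up : ∀ B k σ → k ≤ B →
  ∑ (steps B) (λ st → weight k true (extend σ st)) ≡ ∑ (upTo k) (λ i → weight i false σ)
extend-up B k σ k≤B = trans (∑-steps B _)
  (trans (cong (ℕ._+ ∑ (upTo B) (λ m → weight k true (extend σ (U m)))) (down-step σ))
    (up-steps σ))
  where
  down-step : ∀ σ → weight k true (extend σ D) ≡ 0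
  down-step (ok , height , up) =
    weight-true-down k (ok ∧ not (up ∧ false)) (height >>= λ h → walk h [ D ])
  up-steps : ∀ σ →
    ∑ (upTo B) (λ m → weight k true (extend σ (U m))) ≡ ∑ (upTo k) (λ i → weight i false σ)
  up-steps (false , _       , _)     = trans (∑-ε (upTo B)) (sym (∑-ε (upTo k)))
  up-steps (true  , nothing , false) = trans (∑-ε (upTo B)) (sym (∑-ε (upTo k)))
  up-steps (true  , nothing , true)  = trans (∑-ε (upTo B)) (sym (∑-ε (upTo k)))
  up-steps (true  , just h  , true)  = trans (∑-ε (upTo B)) (sym (∑-ε (upTo k)))
  up-steps (true  , just h  , false) =
    trans (∑-cong (λ m → cong (λ height → weight k true (true , height , true)) (walk-U h m)) (upTo B))
      (trans (∑-𝟙-up h B k (ℕP.≤-trans k≤B (ℕP.m≤n+m B h))) (sym (∑-𝟙≡ᵇ h k)))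

∑-allSeqs-suc : ∀ B n (w : List Step → ℕ) →
  ∑ (allSeqs B (suc n)) w ≡ ∑ (steps B) (λ st → ∑ (allSeqs B n) (λ s → w (st ∷ s)))
∑-allSeqs-suc B n w = trans (∑-concatMap (λ st → map (st ∷_) (allSeqs B n)) (steps B) w)
  (∑-cong (λ st → ∑-map (st ∷_) (allSeqs B n) w) (steps B))

∑-allSeqs-∷ʳ : ∀ B n (w : List Step → ℕ) →
  ∑ (allSeqs B (suc n)) w ≡ ∑ (allSeqs B n) (λ s → ∑ (steps B) (λ st → w (s ∷ʳ st)))
∑-allSeqs-∷ʳ B zero w =
  trans (∑-allSeqs-suc B 0 w) (∑-comm (steps B) (allSeqs B 0) (λ st s → w (st ∷ s)))
∑-allSeqs-∷ʳ B (suc n) w = begin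
  ∑ (allSeqs B (suc (suc n))) w
    ≡⟨ ∑-allSeqs-suc B (suc n) w ⟩
  ∑ (steps B) (λ st → ∑ (allSeqs B (suc n)) (λ s → w (st ∷ s)))
    ≡⟨ ∑-cong (λ st → ∑-allSeqs-∷ʳ B n (λ s → w (st ∷ s))) (steps B) ⟩
  ∑ (steps B) (λ st → ∑ (allSeqs B n) (λ s → ∑ (steps B) (λ st' → w (st ∷ s ∷ʳ st'))))
    ≡⟨ sym (∑-allSeqs-suc B n (λ s → ∑ (steps B) (λ st' → w (s ∷ʳ st')))) ⟩
  ∑ (allSeqs B (suc n)) (λ s → ∑ (steps B) (λ st → w (s ∷ʳ st))) ∎
  where open ≡-Reasoning

enumCount : ℕ → ℕ → ℕ → Bool → ℕ
enumCount B n k up = ∑ (allSeqs B n) (λ s → weight k up (summary s))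

enumCount-∷ʳ : ∀ B n k up →
  enumCount B (suc n) k up ≡
  ∑ (allSeqs B n) (λ s → ∑ (steps B) (λ st → weight k up (extend (summary s) st)))
enumCount-∷ʳ B n k up = trans (∑-allSeqs-∷ʳ B n (λ s → weight k up (summary s)))
  (∑-cong (λ s → ∑-cong (λ st → cong (weight k up) (summary-∷ʳ s st)) (steps B)) (allSeqs B n))

pathCount : ℕ → ℕ → Bool → ℕ
pathCount zero    k up    = weight k up (summary [])
pathCount (suc n) k false = pathCount n (suc k) true ℕ.+ pathCount n (suc k) false
pathCount (suc n) k true  = ∑ (upTo k) (λ i → pathCount n i false)

-- A path of n steps ending at height k uses no up-step higher than k + n, so B ≥ k + n loses nothing.
enumCount≡pathCount : ∀ B n k up → k ℕ.+ n ≤ B → enumCount B n k up ≡ pathCount n k up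
enumCount≡pathCount B zero    k up    _ = ℕP.+-identityʳ _
enumCount≡pathCount B (suc n) k false k+1+n≤B = begin
  enumCount B (suc n) k false
    ≡⟨ enumCount-∷ʳ B n k false ⟩
  ∑ (allSeqs B n) (λ s → ∑ (steps B) (λ st → weight k false (extend (summary s) st)))
    ≡⟨ ∑-cong (λ s → extend-down B k (summary s)) (allSeqs B n) ⟩
  ∑ (allSeqs B n) (λ s → weight (suc k) true (summary s) ℕ.+ weight (suc k) false (summary s))
    ≡⟨ ∑-∙ _ _ (allSeqs B n) ⟩
  enumCount B n (suc k) true ℕ.+ enumCount B n (suc k) false
    ≡⟨ cong₂ ℕ._+_ (enumCount≡pathCount B n (suc k) true bound)
                   (enumCount≡pathCount B n (suc k) false bound) ⟩
  pathCount (suc n) k false ∎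
  where
  open ≡-Reasoning
  bound = subst (_≤ B) (ℕP.+-suc k n) k+1+n≤B
enumCount≡pathCount B (suc n) k true k+1+n≤B = begin
  enumCount B (suc n) k true
    ≡⟨ enumCount-∷ʳ B n k true ⟩
  ∑ (allSeqs B n) (λ s → ∑ (steps B) (λ st → weight k true (extend (summary s) st)))
    ≡⟨ ∑-cong (λ s → extend-up B k (summary s) (ℕP.≤-trans (ℕP.m≤m+n k (suc n)) k+1+n≤B))
              (allSeqs B n) ⟩
  ∑ (allSeqs B n) (λ s → ∑ (upTo k) (λ i → weight i false (summary s)))
    ≡⟨ ∑-comm (allSeqs B n) (upTo k) (λ s i → weight i false (summary s)) ⟩
  ∑ (upTo k) (λ i → enumCount B n i false)
    ≡⟨ ∑-upTo-cong k (λ i i<k → enumCount≡pathCount B n i false (bound i<k)) ⟩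
  pathCount (suc n) k true ∎
  where
  open ≡-Reasoning
  bound : ∀ {i} → i < k → i ℕ.+ n ≤ B
  bound i<k = ℕP.≤-trans (ℕP.+-monoˡ-≤ n (ℕP.<⇒≤ i<k))
    (ℕP.≤-trans (ℕP.+-monoʳ-≤ k (ℕP.n≤1+n n)) k+1+n≤B)

pathCount-gf : ∀ n k →
  fromℕℚ (pathCount n k false) ≡ Dgf k n × fromℕℚ (pathCount n k true) ≡ Ugf k n
pathCount-gf zero zero    = refl , refl
pathCount-gf zero (suc k) = sym (Z⊛-zero (d₂ ⊛ s₂ ^^ suc k)) , sym (Z⊛-zero (s₂ ^^ suc k))
pathCount-gf (suc n) k    = down k , up k
  where
  down : ∀ k → fromℕℚ (pathCount (suc n) k false) ≡ Dgf k (suc n)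
  down k = trans (fromℕℚ-+ (pathCount n (suc k) true) (pathCount n (suc k) false))
    (trans (cong₂ _+_ (proj₂ (pathCount-gf n (suc k))) (proj₁ (pathCount-gf n (suc k))))
      (sym (Dgf-suc k n)))
  up : ∀ k → fromℕℚ (pathCount (suc n) k true) ≡ Ugf k (suc n)
  up zero    = refl
  up (suc k) = trans (fromℕℚ-∑ (upTo (suc k)) (λ i → pathCount n i false))
    (trans (ℚ∑.∑-cong (λ i → proj₁ (pathCount-gf n i)) (upTo (suc k))) (sym (Ugf-suc k n)))

length-filter : ∀ k xs → length (filter (λ s → T? (valid k s)) xs) ≡ ∑ xs (λ s → 𝟙 (valid k s))
length-filter k []       = refl
length-filter k (s ∷ xs) with valid k s
... | true  = cong suc (length-filter k xs)
... | false = length-filter k xs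

𝟙-valid : ∀ k st s →
  𝟙 (valid k (st ∷ s)) ≡ weight k true (summary (st ∷ s)) ℕ.+ weight k false (summary (st ∷ s))
𝟙-valid k st s = split (noUU (st ∷ s)) (walk 0 (st ∷ s)) (endsUp (st ∷ s))
  where
  split : ∀ ok height up →
    𝟙 (ok ∧ endsAt k height) ≡ weight k true (ok , height , up) ℕ.+ weight k false (ok , height , up)
  split false _        _     = refl
  split true  nothing  _     = refl
  split true  (just h) true  = sym (ℕP.+-identityʳ _)
  split true  (just h) false = refl

bcount-suc : ∀ k n → bcount k (suc n) ≡ pathCount (suc n) k true ℕ.+ pathCount (suc n) k false
bcount-suc k n = begin
  bcount k (suc n)
    ≡⟨ length-filter k (allSeqs B (suc n)) ⟩
  ∑ (allSeqs B (suc n)) (λ s → 𝟙 (valid k s))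
    ≡⟨ ∑-allSeqs-suc B n _ ⟩
  ∑ (steps B) (λ st → ∑ (allSeqs B n) (λ s → 𝟙 (valid k (st ∷ s))))
    ≡⟨ ∑-cong (λ st → ∑-cong (𝟙-valid k st) (allSeqs B n)) (steps B) ⟩
  ∑ (steps B) (λ st → ∑ (allSeqs B n) (λ s →
    weight k true (summary (st ∷ s)) ℕ.+ weight k false (summary (st ∷ s))))
    ≡⟨ sym (∑-allSeqs-suc B n _) ⟩
  ∑ (allSeqs B (suc n)) (λ s → weight k true (summary s) ℕ.+ weight k false (summary s))
    ≡⟨ ∑-∙ _ _ (allSeqs B (suc n)) ⟩
  enumCount B (suc n) k true ℕ.+ enumCount B (suc n) k false
    ≡⟨ cong₂ ℕ._+_ (enumCount≡pathCount B (suc n) k true ℕP.≤-refl)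
                   (enumCount≡pathCount B (suc n) k false ℕP.≤-refl) ⟩
  pathCount (suc n) k true ℕ.+ pathCount (suc n) k false ∎
  where
  open ≡-Reasoning
  B = k ℕ.+ suc n

b-suc : ∀ k n → b k (suc n) ≡ Ugf k (suc n) + Dgf k (suc n)
b-suc k n = trans (cong fromℕℚ (bcount-suc k n))
  (trans (fromℕℚ-+ (pathCount (suc n) k true) (pathCount (suc n) k false))
    (cong₂ _+_ (proj₂ (pathCount-gf (suc n) k)) (proj₁ (pathCount-gf (suc n) k))))

mainTheorem2 : (one ⊕ b 0 ≋ s₂)
    × ((k : ℕ) → 1 ≤ k → b k ≋ divZ (s₂ ⊖ one) ⊛ s₂ ^^ (k ∸ 1))
mainTheorem2 = b₀ , bₖ
  where
  b₀ : one ⊕ b 0 ≋ s₂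
  b₀ zero    = refl
  b₀ (suc n) = trans (cong (0ℚ +_) (b-suc 0 n)) (trans (QP.+-identityˡ _) (QP.+-identityˡ _))
  bₖ : (k : ℕ) → 1 ≤ k → b k ≋ d₂ ⊛ s₂ ^^ (k ∸ 1)
  bₖ (suc k) _ zero    = sym (cong (_+ 0ℚ) (QP.*-zeroˡ ((s₂ ^^ k) 0)))
  bₖ (suc k) _ (suc n) = trans (b-suc (suc k) n) (sym (d₂⊛s₂^-unfold k (suc n)))
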